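{- For every integer $n\ge 1$, $$ n B_n=\sum_{j=1}^n\bigl(B_j B_{n-j+1}-B_{j-1}B_{n-j}\bigr)\,. $$
   Context: The balancing numbers $B_n$ are defined by $B_0=0$, $B_1=1$ and $B_n=6B_{n-1}-B_{n-2}$ for $n\ge 2$. -}

module Defs where

open import Data.Nat using (ℕ; zero; suc)
open import Data.Integer using (ℤ; +_; _+_; _-_; _*_)

B : ℕ → ℤ
B zero = + 0
B (suc zero) = + 1
B (suc (suc n)) = + 6 * B (suc n) - B n

sumFrom1 : ℕ → (ℕ → ℤ) → ℤ
sumFrom1 zero f = + 0
sumFrom1 (suc n) f = sumFrom1 n f + f (suc n)

-- Every summand B_j B_{n-j+1} - B_{j-1} B_{n-j} equals B_n by the addition
-- formula B_{a+b+1} = B_{a+1} B_{b+1} - B_a B_b, so the sum is n copies of B_n.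
module Submission where

open import Data.Nat using (ℕ; _≥_; _∸_; suc; zero; _≤_)
import Data.Nat as ℕ
import Data.Nat.Properties as ℕ
open import Data.Integer using (ℤ; +_; _-_; _*_; _+_)
import Data.Integer.Properties as ℤ
open import Data.Integer.Tactic.RingSolver using (solve-∀)
open import Relation.Binary.PropositionalEquality
open ≡-Reasoning
open import Defs

B-addition : ∀ a b → B (suc (b ℕ.+ a)) ≡ B (suc a) * B (suc b) - B a * B b
B-addition a zero = base (B (suc a)) (B a)
  where
  base : ∀ (x z : ℤ) → x ≡ x * + 1 - z * + 0
  base = solve-∀
B-addition a (suc zero) = base (B (suc a)) (B a)
  where
  base : ∀ (x z : ℤ) → + 6 * x - z ≡ x * (+ 6 * + 1 - + 0) - z * + 1
  base = solve-∀
B-addition a (suc (suc b)) = begin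
  + 6 * B (suc (suc b ℕ.+ a)) - B (suc (b ℕ.+ a))
    ≡⟨ cong₂ (λ p q → + 6 * p - q) (B-addition a (suc b)) (B-addition a b) ⟩
  + 6 * (B (suc a) * B (suc (suc b)) - B a * B (suc b))
    - (B (suc a) * B (suc b) - B a * B b)
    ≡⟨ recurrence-bilinear (B (suc a)) (B a) (B (suc (suc b))) (B (suc b)) (B b) ⟩
  B (suc a) * B (suc (suc (suc b))) - B a * B (suc (suc b)) ∎
  where
  recurrence-bilinear : ∀ (x z y w v : ℤ) →
    + 6 * (x * y - z * w) - (x * w - z * v) ≡ x * (+ 6 * y - w) - z * (+ 6 * w - v)
  recurrence-bilinear = solve-∀

balancing-summand≡B : ∀ {n j} → suc j ≤ n →
  B (suc j) * B (suc (n ∸ suc j)) - B j * B (n ∸ suc j) ≡ B n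
balancing-summand≡B {n} {j} j<n = begin
  B (suc j) * B (suc (n ∸ suc j)) - B j * B (n ∸ suc j)
    ≡⟨ B-addition j (n ∸ suc j) ⟨
  B (suc (n ∸ suc j ℕ.+ j))
    ≡⟨ cong B (trans (sym (ℕ.+-suc (n ∸ suc j) j)) (ℕ.m∸n+n≡m j<n)) ⟩
  B n ∎

sumFrom1-const : ∀ m (f : ℕ → ℤ) (c : ℤ) →
  (∀ {j} → j ℕ.< m → f (suc j) ≡ c) → sumFrom1 m f ≡ + m * c
sumFrom1-const zero f c _ = refl
sumFrom1-const (suc m) f c f≡c = begin
  sumFrom1 m f + f (suc m)
    ≡⟨ cong₂ _+_ (sumFrom1-const m f c (λ j<m → f≡c (ℕ.m<n⇒m<1+n j<m))) (f≡c ℕ.≤-refl) ⟩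
  + m * c + c            ≡⟨ ℤ.+-comm (+ m * c) c ⟩
  c + + m * c            ≡⟨ ℤ.suc-* (+ m) c ⟨
  + suc m * c ∎

theorem1 : (n : ℕ) → n ≥ 1 →
    + n * B n ≡ sumFrom1 n (λ j → B j * B (suc (n ∸ j)) - B (j ∸ 1) * B (n ∸ j))
theorem1 n _ = sym (sumFrom1-const n _ (B n) balancing-summand≡B)
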